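{- For every odd integer $m\ge3$, $m=2M+1$, and every integer $j$, define the polynomials $$F_m^{(j)}(x,y)=\sum_{s=1}^{M-1}\left(\frac{ -2}{2s-1}\sum_{n=0}^{m-2s}\binom{j}{m-2s-n}\binom{n+2s-2}{n}B_n\right)x^{2M-2s}y^{2s-1},$$ $$G_m^{(j)}(x,y)=\sum_{s=1}^{M-1}\left(\frac{2}{2s-1}\sum_{n=0}^{m-2s}\binom{m-2-j}{m-2s-n}\binom{n+2s-2}{n}B_n\right)x^{2M-2s}y^{2s-1}$$ (for $m=3$ the sums are empty, so $F_3^{(j)}=G_3^{(j)}=0$). Let $k=2K+1\ge5$ be odd and $0\le i\le k-2$. Then $$\frac{\partial^2}{\partial y^2}F_k^{(i)}(x,y)=(k-2-i)(k-3-i)F_{k-2}^{(i)}(x,y)-2i(k-2-i)G_{k-2}^{(k-3-i)}(x,y)+i(i-1)F_{k-2}^{(i-2)}(x,y),$$ $$\frac{\partial^2}{\partial y^2}G_k^{(i)}(x,y)=(k-2-i)(k-3-i)G_{k-2}^{(i)}(x,y)-2i(k-2-i)F_{k-2}^{(k-3-i)}(x,y)+i(i-1)G_{k-2}^{(i-2)}(x,y).$$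
   Context: $B_n$ is the $n$th Bernoulli number, defined by $\frac{t}{e^t-1}=\sum_{n\ge0}B_n\frac{t^n}{n!}$ (so $B_1=-\tfrac12$). For an integer $a$ and an integer $m$, $\binom{a}{m}=\frac{a(a-1)\cdots(a-m+1)}{m!}$ if $m\ge0$ and $\binom{a}{m}=0$ if $m<0$; for $a\ge0$ this is the usual binomial coefficient. -}

module Defs where

open import Data.Nat as ℕ using (ℕ; zero; suc)
open import Data.Nat.Combinatorics using (_C_)
open import Data.Integer as ℤ using (ℤ; +_)
open import Data.Rational as ℚ using (ℚ; _/_; _+_; _*_; -_; 0ℚ; 1ℚ)
open import Data.Fin using (Fin; toℕ)
open import Data.Vec using (Vec; []; _∷ʳ_; lookup)
open import Data.List using (List; []; _∷_; _++_; map; foldr; upTo)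
open import Data.Product using (_×_; _,_)
open import Data.Bool using (if_then_else_; _∧_)
open import Relation.Binary.PropositionalEquality using (_≡_)
open import Relation.Nullary.Decidable using (⌊_⌋)

ℤtoℚ : ℤ → ℚ
ℤtoℚ z = z / 1

ℕtoℚ : ℕ → ℚ
ℕtoℚ n = (+ n) / 1

ΣFin : (n : ℕ) → (Fin n → ℚ) → ℚ
ΣFin zero    f = 0ℚ
ΣFin (suc n) f = f Fin.zero + ΣFin n (λ k → f (Fin.suc k))
  where import Data.Fin as Fin

Σ< : ℕ → (ℕ → ℚ) → ℚ
Σ< n f = foldr (λ k acc → f k + acc) 0ℚ (upTo n)

-- Bernoulli numbers (convention B₁ = -1/2), via the standard recursion
-- Σ_{k=0}^{n} C(n+1,k) B_k = 0 for n ≥ 1, equivalent to t/(e^t-1) = Σ B_n t^n/n!.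
-- bernVec n = (B₀, …, B_{n-1})
bernNext : (n : ℕ) → Vec ℚ n → ℚ
bernNext zero    v = 1ℚ
bernNext (suc n) v =
  - ((+ 1 / suc (suc n)) * ΣFin (suc n) (λ k → ℕtoℚ (suc (suc n) C toℕ k) * lookup v k))

bernVec : (n : ℕ) → Vec ℚ n
bernVec zero    = []
bernVec (suc n) = bernVec n ∷ʳ bernNext n (bernVec n)

bernoulli : ℕ → ℚ
bernoulli n = bernNext n (bernVec n)

binomℤ : ℤ → ℕ → ℚ
binomℤ a zero    = 1ℚ
binomℤ a (suc m) = binomℤ a m * (ℤtoℚ (a ℤ.- + m) * (+ 1 / suc m))

-- Polynomials in x, y over ℚ: finite lists of terms c·x^a·y^b, (c , a , b)
Poly : Set
Poly = List (ℚ × ℕ × ℕ)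

_⊕_ : Poly → Poly → Poly
p ⊕ q = p ++ q

infixl 6 _⊕_
infixl 7 _·_

_·_ : ℚ → Poly → Poly
c · p = map (λ { (d , a , b) → (c * d , a , b) }) p

coeff : ℕ → ℕ → Poly → ℚ
coeff a b p = foldr (λ { (c , a' , b') acc →
  (if ⌊ a ℕ.≟ a' ⌋ ∧ ⌊ b ℕ.≟ b' ⌋ then c else 0ℚ) + acc }) 0ℚ p

_≈ₚ_ : Poly → Poly → Set
p ≈ₚ q = ∀ a b → coeff a b p ≡ coeff a b q

infix 4 _≈ₚ_

∂y² : Poly → Poly
∂y² p = map (λ { (c , a , b) → (c * ℕtoℚ (b ℕ.* (b ℕ.∸ 1)) , a , b ℕ.∸ 2) }) p

-- Inner sum  Σ_{n=0}^{m-2s} binom(a, m-2s-n) binom(n+2s-2, n) B_n,  with L = m - 2s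
innerSum : ℤ → ℕ → ℕ → ℚ
innerSum a L s = Σ< (suc L) (λ n →
  binomℤ a (L ℕ.∸ n) * ℕtoℚ ((n ℕ.+ 2 ℕ.* s ℕ.∸ 2) C n) * bernoulli n)

-- F_m^{(j)} and G_m^{(j)} for m = 2M+1; the summation index s runs over 1..M-1,
-- written s = t+1 with t = 0..M-2 (so 2s-1 = suc (2t) and m-2s = 2M-1-2t)
F : (M : ℕ) → ℤ → Poly
F M j = map (λ t →
   (ℤ.-[1+ 1 ] / suc (2 ℕ.* t)) * innerSum j (2 ℕ.* M ℕ.∸ 1 ℕ.∸ 2 ℕ.* t) (suc t)
   , 2 ℕ.* M ℕ.∸ 2 ℕ.* suc t , suc (2 ℕ.* t))
  (upTo (M ℕ.∸ 1))

G : (M : ℕ) → ℤ → Poly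
G M j = map (λ t →
   ((+ 2) / suc (2 ℕ.* t)) * innerSum ((+ (2 ℕ.* M ℕ.+ 1)) ℤ.- + 2 ℤ.- j) (2 ℕ.* M ℕ.∸ 1 ℕ.∸ 2 ℕ.* t) (suc t)
   , 2 ℕ.* M ℕ.∸ 2 ℕ.* suc t , suc (2 ℕ.* t))
  (upTo (M ℕ.∸ 1))

{-# OPTIONS --safe #-}
-- The coefficient of y^(2s-1) in F_k^(j) and G_k^(j) is ∓2/(2s-1) times the inner sum
-- S(a, L, s) = Σ_n binom(a, L-n) binom(n+2s-2, n) B_n, with a = j for F and a = k-2-j for G, so both
-- belong to one family Φ. Since ∂²/∂y² multiplies y^(2s+1) by (2s+1)(2s) and lowers s by one, the
-- theorem reduces to a recurrence for S in s, which holds term by term in n whatever the B_n are: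
-- (2s)(2s-1) binom(n+2s, n) = (m+2)(m+1) binom(m, n) with m = n+2s-2, and by absorption
-- (m+2)(m+1) binom(a, p) is a combination of binom(a, p), binom(a-1, p) and binom(a-2, p) whose
-- coefficients are those of the theorem.
module Submission where

open import Level using (0ℓ)
open import Data.Bool using (Bool; true; false; if_then_else_; _∧_)
open import Data.Nat as ℕ using (ℕ; zero; suc; _<_; _≤_)
import Data.Nat.Properties as ℕ
import Data.Nat.Tactic.RingSolver as ℕ-Solver
open import Data.Nat.Combinatorics using (_C_; nC1≡n; nCk+nC[k+1]≡[n+1]C[k+1])
open import Data.Integer as ℤ using (ℤ; +_)
import Data.Integer.Properties as ℤ
import Data.Integer.Tactic.RingSolver as ℤ-Solver
open import Data.Rational using (ℚ; _/_; 0ℚ; 1ℚ; toℚᵘ)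
open import Data.Rational.Properties
  using (*-distribˡ-+; +-identityˡ; *-identityˡ; *-zeroˡ; *-zeroʳ; +-assoc; +-*-commutativeRing; _≟_;
         toℚᵘ-injective; toℚᵘ-fromℚᵘ; toℚᵘ-homo-+; toℚᵘ-homo-*; toℚᵘ-homo‿-)
open import Data.Rational.Unnormalised as ℚᵘ using (mkℚᵘ; *≡*)
import Data.Rational.Unnormalised.Properties as ℚᵘ
open import Data.List using (List; []; _∷_; map; foldr; upTo)
import Data.List as List using (applyUpTo)
import Data.List.Properties as List
open import Data.List.Relation.Unary.All as All using (All; []; _∷_)
open import Data.List.Relation.Unary.All.Properties using (all-upTo)
open import Data.Product using (_×_; _,_; proj₁; proj₂)
open import Relation.Nullary.Decidable using (⌊_⌋; dec⇒maybe)
open import Relation.Binary.PropositionalEquality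
open import Function using (_∘_)
open import Tactic.RingSolver using (solve-∀)
open import Tactic.RingSolver.Core.AlmostCommutativeRing using (AlmostCommutativeRing; fromCommutativeRing)
open import Defs

module _ where

  open import Data.Rational using (_+_; _*_; -_; _-_)

  ℚ-ring : AlmostCommutativeRing 0ℓ 0ℓ
  ℚ-ring = fromCommutativeRing +-*-commutativeRing (λ x → dec⇒maybe (0ℚ ≟ x))

  toℚᵘ-/ : ∀ z d → toℚᵘ (z / suc d) ℚᵘ.≃ mkℚᵘ z d
  toℚᵘ-/ z d = toℚᵘ-fromℚᵘ (mkℚᵘ z d)

  ℤtoℚ-+ : ∀ x y → ℤtoℚ (x ℤ.+ y) ≡ ℤtoℚ x + ℤtoℚ y
  ℤtoℚ-+ x y = toℚᵘ-injective (ℚᵘ.≃-trans (toℚᵘ-/ (x ℤ.+ y) 0) (ℚᵘ.≃-sym (ℚᵘ.≃-trans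
    (toℚᵘ-homo-+ (ℤtoℚ x) (ℤtoℚ y)) (ℚᵘ.≃-trans (ℚᵘ.+-cong (toℚᵘ-/ x 0) (toℚᵘ-/ y 0)) (*≡* (eq x y))))))
    where
    eq : ∀ x y → (x ℤ.* + 1 ℤ.+ y ℤ.* + 1) ℤ.* + 1 ≡ (x ℤ.+ y) ℤ.* + 1
    eq = ℤ-Solver.solve-∀

  ℤtoℚ-* : ∀ x y → ℤtoℚ (x ℤ.* y) ≡ ℤtoℚ x * ℤtoℚ y
  ℤtoℚ-* x y = toℚᵘ-injective (ℚᵘ.≃-trans (toℚᵘ-/ (x ℤ.* y) 0) (ℚᵘ.≃-sym (ℚᵘ.≃-trans
    (toℚᵘ-homo-* (ℤtoℚ x) (ℤtoℚ y)) (ℚᵘ.≃-trans (ℚᵘ.*-cong (toℚᵘ-/ x 0) (toℚᵘ-/ y 0)) (*≡* refl)))))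

  ℤtoℚ-neg : ∀ x → ℤtoℚ (ℤ.- x) ≡ - ℤtoℚ x
  ℤtoℚ-neg x = toℚᵘ-injective (ℚᵘ.≃-trans (toℚᵘ-/ (ℤ.- x) 0) (ℚᵘ.≃-sym (ℚᵘ.≃-trans
    (toℚᵘ-homo‿- (ℤtoℚ x)) (ℚᵘ.≃-trans (ℚᵘ.-‿cong (toℚᵘ-/ x 0)) (*≡* refl)))))

  ℤtoℚ-- : ∀ x y → ℤtoℚ (x ℤ.- y) ≡ ℤtoℚ x - ℤtoℚ y
  ℤtoℚ-- x y = trans (ℤtoℚ-+ x (ℤ.- y)) (cong (λ q → ℤtoℚ x + q) (ℤtoℚ-neg y))

  ℕtoℚ-+ : ∀ m n → ℕtoℚ (m ℕ.+ n) ≡ ℕtoℚ m + ℕtoℚ n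
  ℕtoℚ-+ m n = trans (cong ℤtoℚ (ℤ.pos-+ m n)) (ℤtoℚ-+ (+ m) (+ n))

  ℕtoℚ-* : ∀ m n → ℕtoℚ (m ℕ.* n) ≡ ℕtoℚ m * ℕtoℚ n
  ℕtoℚ-* m n = trans (cong ℤtoℚ (ℤ.pos-* m n)) (ℤtoℚ-* (+ m) (+ n))

  z/n≡z*[1/n] : ∀ z d → z / suc d ≡ ℤtoℚ z * (+ 1 / suc d)
  z/n≡z*[1/n] z d = toℚᵘ-injective (ℚᵘ.≃-trans (toℚᵘ-/ z d) (ℚᵘ.≃-sym (ℚᵘ.≃-trans
    (toℚᵘ-homo-* (ℤtoℚ z) (+ 1 / suc d)) (ℚᵘ.≃-trans (ℚᵘ.*-cong (toℚᵘ-/ z 0) (toℚᵘ-/ (+ 1) d)) (*≡* eq)))))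
    where
    eq : z ℤ.* + 1 ℤ.* + suc d ≡ z ℤ.* + suc (d ℕ.+ 0)
    eq = trans (cong (ℤ._* + suc d) (ℤ.*-identityʳ z)) (cong (λ n → z ℤ.* + suc n) (sym (ℕ.+-identityʳ d)))

  1/n*n≡1 : ∀ d → (+ 1 / suc d) * ℕtoℚ (suc d) ≡ 1ℚ
  1/n*n≡1 d = toℚᵘ-injective (ℚᵘ.≃-trans (toℚᵘ-homo-* (+ 1 / suc d) (ℕtoℚ (suc d)))
    (ℚᵘ.≃-trans (ℚᵘ.*-cong (toℚᵘ-/ (+ 1) d) (toℚᵘ-/ (+ suc d) 0)) (*≡* eq)))
    where
    eq : + 1 ℤ.* + suc d ℤ.* + 1 ≡ + 1 ℤ.* + (suc d ℕ.* 1)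
    eq = trans (ℤ.*-identityʳ _) (cong (λ n → + 1 ℤ.* + n) (sym (ℕ.*-identityʳ (suc d))))

  +-combination₃ : ∀ α β γ x y z x′ y′ z′ →
    (α * x + β * y + γ * z) + (α * x′ + β * y′ + γ * z′) ≡ α * (x + x′) + β * (y + y′) + γ * (z + z′)
  +-combination₃ = solve-∀ ℚ-ring

  sumOver : List ℕ → (ℕ → ℚ) → ℚ
  sumOver xs f = foldr (λ k acc → f k + acc) 0ℚ xs

  *-sumOver-combination₃ : ∀ c α β γ {f f₁ f₂ f₃ : ℕ → ℚ} {xs} →
    All (λ k → c * f k ≡ α * f₁ k + β * f₂ k + γ * f₃ k) xs →
    c * sumOver xs f ≡ α * sumOver xs f₁ + β * sumOver xs f₂ + γ * sumOver xs f₃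
  *-sumOver-combination₃ c α β γ [] = zeros c α β γ
    where
    zeros : ∀ c α β γ → c * 0ℚ ≡ α * 0ℚ + β * 0ℚ + γ * 0ℚ
    zeros = solve-∀ ℚ-ring
  *-sumOver-combination₃ c α β γ {f} {f₁} {f₂} {f₃} {k ∷ xs} (eq ∷ eqs) = begin
    c * (f k + sumOver xs f)                                  ≡⟨ *-distribˡ-+ c (f k) (sumOver xs f) ⟩
    c * f k + c * sumOver xs f                                ≡⟨ cong₂ _+_ eq (*-sumOver-combination₃ c α β γ eqs) ⟩
    (α * f₁ k + β * f₂ k + γ * f₃ k)
      + (α * sumOver xs f₁ + β * sumOver xs f₂ + γ * sumOver xs f₃) ≡⟨ +-combination₃ α β γ _ _ _ _ _ _ ⟩
    α * sumOver (k ∷ xs) f₁ + β * sumOver (k ∷ xs) f₂ + γ * sumOver (k ∷ xs) f₃ ∎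
    where open ≡-Reasoning

  select : Bool → ℚ → ℚ
  select x c = if x then c else 0ℚ

  select-* : ∀ x c → select x c ≡ select x 1ℚ * c
  select-* true  c = sym (*-identityˡ c)
  select-* false c = sym (*-zeroˡ c)

  coeff-⊕ : ∀ a b p q → coeff a b (p ⊕ q) ≡ coeff a b p + coeff a b q
  coeff-⊕ a b []                  q = sym (+-identityˡ (coeff a b q))
  coeff-⊕ a b ((c , a′ , b′) ∷ p) q = begin
    s + coeff a b (p ⊕ q)               ≡⟨ cong (λ r → s + r) (coeff-⊕ a b p q) ⟩
    s + (coeff a b p + coeff a b q)     ≡⟨ +-assoc s _ _ ⟨
    s + coeff a b p + coeff a b q       ∎
    where
    open ≡-Reasoning
    s = select (⌊ a ℕ.≟ a′ ⌋ ∧ ⌊ b ℕ.≟ b′ ⌋) c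

  coeff-· : ∀ a b k p → coeff a b (k · p) ≡ k * coeff a b p
  coeff-· a b k []                  = sym (*-zeroʳ k)
  coeff-· a b k ((c , a′ , b′) ∷ p) = begin
    select x (k * c) + coeff a b (k · p)   ≡⟨ cong₂ _+_ (select-* x (k * c)) (coeff-· a b k p) ⟩
    s * (k * c) + k * coeff a b p          ≡⟨ distrib k s c (coeff a b p) ⟩
    k * (s * c + coeff a b p)              ≡⟨ cong (λ r → k * (r + coeff a b p)) (select-* x c) ⟨
    k * (select x c + coeff a b p)         ∎
    where
    open ≡-Reasoning
    x = ⌊ a ℕ.≟ a′ ⌋ ∧ ⌊ b ℕ.≟ b′ ⌋
    s = select x 1ℚ
    distrib : ∀ k s c r → s * (k * c) + k * r ≡ k * (s * c + r)
    distrib = solve-∀ ℚ-ring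

  coeff-combination₃ : ∀ a b α β γ p q r →
    coeff a b (α · p ⊕ β · q ⊕ γ · r) ≡ α * coeff a b p + β * coeff a b q + γ * coeff a b r
  coeff-combination₃ a b α β γ p q r =
    trans (coeff-⊕ a b (α · p ⊕ β · q) (γ · r))
          (cong₂ _+_ (trans (coeff-⊕ a b (α · p) (β · q)) (cong₂ _+_ (coeff-· a b α p) (coeff-· a b β q)))
                     (coeff-· a b γ r))

  ⊕-reverse : ∀ p q r → p ⊕ q ⊕ r ≈ₚ r ⊕ q ⊕ p
  ⊕-reverse p q r a b = begin
    coeff a b (p ⊕ q ⊕ r)                       ≡⟨ coeff-⊕₃ p q r ⟩
    coeff a b p + coeff a b q + coeff a b r       ≡⟨ reverse (coeff a b p) (coeff a b q) (coeff a b r) ⟩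
    coeff a b r + coeff a b q + coeff a b p       ≡⟨ coeff-⊕₃ r q p ⟨
    coeff a b (r ⊕ q ⊕ p)                       ∎
    where
    open ≡-Reasoning
    coeff-⊕₃ : ∀ p q r → coeff a b (p ⊕ q ⊕ r) ≡ coeff a b p + coeff a b q + coeff a b r
    coeff-⊕₃ p q r = trans (coeff-⊕ a b (p ⊕ q) r) (cong (λ s → s + coeff a b r) (coeff-⊕ a b p q))
    reverse : ∀ x y z → x + y + z ≡ z + y + x
    reverse = solve-∀ ℚ-ring

  terms : (ℕ → ℚ) → (ℕ → ℕ × ℕ) → List ℕ → Poly
  terms u e xs = map (λ t → u t , e t) xs

  terms-combination₃ : ∀ α β γ (u₁ u₂ u₃ : ℕ → ℚ) e xs →
    terms (λ t → α * u₁ t + β * u₂ t + γ * u₃ t) e xs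
      ≈ₚ α · terms u₁ e xs ⊕ β · terms u₂ e xs ⊕ γ · terms u₃ e xs
  terms-combination₃ α β γ u₁ u₂ u₃ e xs a b =
    trans (coeff-terms xs) (sym (coeff-combination₃ a b α β γ (terms u₁ e xs) (terms u₂ e xs) (terms u₃ e xs)))
    where
    coeff-terms : ∀ xs → coeff a b (terms (λ t → α * u₁ t + β * u₂ t + γ * u₃ t) e xs) ≡
      α * coeff a b (terms u₁ e xs) + β * coeff a b (terms u₂ e xs) + γ * coeff a b (terms u₃ e xs)
    coeff-terms [] = zeros α β γ
      where
      zeros : ∀ α β γ → 0ℚ ≡ α * 0ℚ + β * 0ℚ + γ * 0ℚ
      zeros = solve-∀ ℚ-ring
    coeff-terms (t ∷ xs) = begin
      select x (α * u₁ t + β * u₂ t + γ * u₃ t) + coeff a b (terms _ e xs)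
        ≡⟨ cong₂ _+_ (select-* x _) (coeff-terms xs) ⟩
      s * (α * u₁ t + β * u₂ t + γ * u₃ t)
        + (α * coeff a b (terms u₁ e xs) + β * coeff a b (terms u₂ e xs) + γ * coeff a b (terms u₃ e xs))
        ≡⟨ cong (_+ _) (distrib s α β γ (u₁ t) (u₂ t) (u₃ t)) ⟩
      (α * (s * u₁ t) + β * (s * u₂ t) + γ * (s * u₃ t))
        + (α * coeff a b (terms u₁ e xs) + β * coeff a b (terms u₂ e xs) + γ * coeff a b (terms u₃ e xs))
        ≡⟨ +-combination₃ α β γ _ _ _ _ _ _ ⟩
      α * (s * u₁ t + coeff a b (terms u₁ e xs)) + β * (s * u₂ t + coeff a b (terms u₂ e xs))
        + γ * (s * u₃ t + coeff a b (terms u₃ e xs))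
        ≡⟨ cong₂ _+_ (cong₂ _+_ (cong (α *_) (head u₁)) (cong (β *_) (head u₂))) (cong (γ *_) (head u₃)) ⟩
      α * coeff a b (terms u₁ e (t ∷ xs)) + β * coeff a b (terms u₂ e (t ∷ xs)) + γ * coeff a b (terms u₃ e (t ∷ xs)) ∎
      where
      open ≡-Reasoning
      x = ⌊ a ℕ.≟ proj₁ (e t) ⌋ ∧ ⌊ b ℕ.≟ proj₂ (e t) ⌋
      s = select x 1ℚ
      distrib : ∀ s α β γ x y z → s * (α * x + β * y + γ * z) ≡ α * (s * x) + β * (s * y) + γ * (s * z)
      distrib = solve-∀ ℚ-ring
      head : ∀ v → s * v t + coeff a b (terms v e xs) ≡ coeff a b (terms v e (t ∷ xs))
      head v = cong (λ r → r + coeff a b (terms v e xs)) (sym (select-* x (v t)))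

  [k+1]*[n+1]C[k+1]≡[n+1]*nCk : ∀ n k → suc k ℕ.* (suc n C suc k) ≡ suc n ℕ.* (n C k)
  [k+1]*[n+1]C[k+1]≡[n+1]*nCk n       zero    =
    trans (ℕ.*-identityˡ _) (trans (nC1≡n (suc n)) (sym (ℕ.*-identityʳ (suc n))))
  [k+1]*[n+1]C[k+1]≡[n+1]*nCk zero    (suc k) = ℕ.*-zeroʳ (suc (suc k))
  [k+1]*[n+1]C[k+1]≡[n+1]*nCk (suc n) (suc k) = begin
    (2 ℕ.+ k) ℕ.* (suc (suc n) C suc (suc k))
      ≡⟨ cong ((2 ℕ.+ k) ℕ.*_) (nCk+nC[k+1]≡[n+1]C[k+1] (suc n) (suc k)) ⟨
    (2 ℕ.+ k) ℕ.* (suc n C suc k ℕ.+ suc n C suc (suc k))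
      ≡⟨ split k (suc n C suc k) (suc n C suc (suc k)) ⟩
    suc n C suc k ℕ.+ suc k ℕ.* (suc n C suc k) ℕ.+ suc (suc k) ℕ.* (suc n C suc (suc k))
      ≡⟨ cong₂ (λ x y → suc n C suc k ℕ.+ x ℕ.+ y)
               ([k+1]*[n+1]C[k+1]≡[n+1]*nCk n k) ([k+1]*[n+1]C[k+1]≡[n+1]*nCk n (suc k)) ⟩
    suc n C suc k ℕ.+ suc n ℕ.* (n C k) ℕ.+ suc n ℕ.* (n C suc k)
      ≡⟨ cong (λ x → x ℕ.+ suc n ℕ.* (n C k) ℕ.+ suc n ℕ.* (n C suc k)) (nCk+nC[k+1]≡[n+1]C[k+1] n k) ⟨
    n C k ℕ.+ n C suc k ℕ.+ suc n ℕ.* (n C k) ℕ.+ suc n ℕ.* (n C suc k)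
      ≡⟨ collect n (n C k) (n C suc k) ⟩
    (2 ℕ.+ n) ℕ.* (n C k ℕ.+ n C suc k)
      ≡⟨ cong ((2 ℕ.+ n) ℕ.*_) (nCk+nC[k+1]≡[n+1]C[k+1] n k) ⟩
    (2 ℕ.+ n) ℕ.* (suc n C suc k) ∎
    where
    open ≡-Reasoning
    split : ∀ k x y → (2 ℕ.+ k) ℕ.* (x ℕ.+ y) ≡ x ℕ.+ (1 ℕ.+ k) ℕ.* x ℕ.+ (2 ℕ.+ k) ℕ.* y
    split = ℕ-Solver.solve-∀
    collect : ∀ n x y → x ℕ.+ y ℕ.+ (1 ℕ.+ n) ℕ.* x ℕ.+ (1 ℕ.+ n) ℕ.* y ≡ (2 ℕ.+ n) ℕ.* (x ℕ.+ y)
    collect = ℕ-Solver.solve-∀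

  [n+1]*nCk+k*[n+1]Ck≡[n+1]*[n+1]Ck : ∀ n k → suc n ℕ.* (n C k) ℕ.+ k ℕ.* (suc n C k) ≡ suc n ℕ.* (suc n C k)
  [n+1]*nCk+k*[n+1]Ck≡[n+1]*[n+1]Ck n zero    = ℕ.+-identityʳ _
  [n+1]*nCk+k*[n+1]Ck≡[n+1]*[n+1]Ck n (suc k) = begin
    suc n ℕ.* (n C suc k) ℕ.+ suc k ℕ.* (suc n C suc k)
      ≡⟨ cong (suc n ℕ.* (n C suc k) ℕ.+_) ([k+1]*[n+1]C[k+1]≡[n+1]*nCk n k) ⟩
    suc n ℕ.* (n C suc k) ℕ.+ suc n ℕ.* (n C k)
      ≡⟨ ℕ.+-comm (suc n ℕ.* (n C suc k)) _ ⟩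
    suc n ℕ.* (n C k) ℕ.+ suc n ℕ.* (n C suc k)
      ≡⟨ ℕ.*-distribˡ-+ (suc n) (n C k) (n C suc k) ⟨
    suc n ℕ.* (n C k ℕ.+ n C suc k)
      ≡⟨ cong (suc n ℕ.*_) (nCk+nC[k+1]≡[n+1]C[k+1] n k) ⟩
    suc n ℕ.* (suc n C suc k) ∎
    where open ≡-Reasoning

  [c+1]*[n+c+1]Cn≡[n+c+1]*[n+c]Cn : ∀ n c → suc c ℕ.* (suc (n ℕ.+ c) C n) ≡ suc (n ℕ.+ c) ℕ.* ((n ℕ.+ c) C n)
  [c+1]*[n+c+1]Cn≡[n+c+1]*[n+c]Cn n c = ℕ.+-cancelˡ-≡ (n ℕ.* X) _ _ (begin
    n ℕ.* X ℕ.+ suc c ℕ.* X                           ≡⟨ merge n c X ⟩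
    suc (n ℕ.+ c) ℕ.* X                               ≡⟨ [n+1]*nCk+k*[n+1]Ck≡[n+1]*[n+1]Ck (n ℕ.+ c) n ⟨
    suc (n ℕ.+ c) ℕ.* ((n ℕ.+ c) C n) ℕ.+ n ℕ.* X     ≡⟨ ℕ.+-comm _ (n ℕ.* X) ⟩
    n ℕ.* X ℕ.+ suc (n ℕ.+ c) ℕ.* ((n ℕ.+ c) C n)     ∎)
    where
    open ≡-Reasoning
    X = suc (n ℕ.+ c) C n
    merge : ∀ n c x → n ℕ.* x ℕ.+ suc c ℕ.* x ≡ suc (n ℕ.+ c) ℕ.* x
    merge = ℕ-Solver.solve-∀

  [c+2]*[c+1]*[n+c+2]Cn≡[n+c+2]*[n+c+1]*[n+c]Cn : ∀ n c →
    (2 ℕ.+ c) ℕ.* (1 ℕ.+ c) ℕ.* ((2 ℕ.+ (n ℕ.+ c)) C n)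
      ≡ (2 ℕ.+ (n ℕ.+ c)) ℕ.* (1 ℕ.+ (n ℕ.+ c)) ℕ.* ((n ℕ.+ c) C n)
  [c+2]*[c+1]*[n+c+2]Cn≡[n+c+2]*[n+c+1]*[n+c]Cn n c = begin
    (2 ℕ.+ c) ℕ.* (1 ℕ.+ c) ℕ.* ((2 ℕ.+ m) C n)   ≡⟨ swap (2 ℕ.+ c) (1 ℕ.+ c) ((2 ℕ.+ m) C n) ⟩
    (1 ℕ.+ c) ℕ.* ((2 ℕ.+ c) ℕ.* ((2 ℕ.+ m) C n)) ≡⟨ cong ((1 ℕ.+ c) ℕ.*_) outer ⟩
    (1 ℕ.+ c) ℕ.* ((2 ℕ.+ m) ℕ.* ((1 ℕ.+ m) C n)) ≡⟨ ℕ.*-assoc (1 ℕ.+ c) (2 ℕ.+ m) ((1 ℕ.+ m) C n) ⟨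
    (1 ℕ.+ c) ℕ.* (2 ℕ.+ m) ℕ.* ((1 ℕ.+ m) C n)   ≡⟨ swap (1 ℕ.+ c) (2 ℕ.+ m) ((1 ℕ.+ m) C n) ⟩
    (2 ℕ.+ m) ℕ.* ((1 ℕ.+ c) ℕ.* ((1 ℕ.+ m) C n)) ≡⟨ cong ((2 ℕ.+ m) ℕ.*_) ([c+1]*[n+c+1]Cn≡[n+c+1]*[n+c]Cn n c) ⟩
    (2 ℕ.+ m) ℕ.* ((1 ℕ.+ m) ℕ.* (m C n))       ≡⟨ ℕ.*-assoc (2 ℕ.+ m) (1 ℕ.+ m) (m C n) ⟨
    (2 ℕ.+ m) ℕ.* (1 ℕ.+ m) ℕ.* (m C n)         ∎
    where
    open ≡-Reasoning
    m = n ℕ.+ c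
    swap : ∀ x y z → x ℕ.* y ℕ.* z ≡ y ℕ.* (x ℕ.* z)
    swap = ℕ-Solver.solve-∀
    outer : (2 ℕ.+ c) ℕ.* ((2 ℕ.+ m) C n) ≡ (2 ℕ.+ m) ℕ.* ((1 ℕ.+ m) C n)
    outer = subst (λ k → suc (suc c) ℕ.* (suc k C n) ≡ suc k ℕ.* (k C n)) (ℕ.+-suc n c)
                  ([c+1]*[n+c+1]Cn≡[n+c+1]*[n+c]Cn n (suc c))

  [a-1]Cp*a≡aCp*[a-p] : ∀ a p → binomℤ (a ℤ.- + 1) p * ℤtoℚ a ≡ binomℤ a p * (ℤtoℚ a - ℕtoℚ p)
  [a-1]Cp*a≡aCp*[a-p] a zero    = unit (ℤtoℚ a)
    where
    unit : ∀ A → 1ℚ * A ≡ 1ℚ * (A - 0ℚ)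
    unit = solve-∀ ℚ-ring
  [a-1]Cp*a≡aCp*[a-p] a (suc p) = begin
    b′ * (ℤtoℚ (a ℤ.- + 1 ℤ.- + p) * ι) * A ≡⟨ cong (λ x → b′ * (x * ι) * A) [a-1]-p ⟩
    b′ * ((A - 1ℚ - P) * ι) * A             ≡⟨ step₁ b′ A P ι ⟩
    b′ * A * ((A - 1ℚ - P) * ι)             ≡⟨ cong (_* ((A - 1ℚ - P) * ι)) ([a-1]Cp*a≡aCp*[a-p] a p) ⟩
    b * (A - P) * ((A - 1ℚ - P) * ι)        ≡⟨ step₂ b A P ι ⟩
    b * ((A - P) * ι) * (A - (1ℚ + P))      ≡⟨ cong₂ (λ x y → b * (x * ι) * (A - y)) (ℤtoℚ-- a (+ p)) (ℕtoℚ-+ 1 p) ⟨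
    b * (ℤtoℚ (a ℤ.- + p) * ι) * (A - ℕtoℚ (suc p)) ∎
    where
    open ≡-Reasoning
    A = ℤtoℚ a
    P = ℕtoℚ p
    ι = + 1 / suc p
    b = binomℤ a p
    b′ = binomℤ (a ℤ.- + 1) p
    [a-1]-p : ℤtoℚ (a ℤ.- + 1 ℤ.- + p) ≡ A - 1ℚ - P
    [a-1]-p = trans (ℤtoℚ-- (a ℤ.- + 1) (+ p)) (cong (_- P) (ℤtoℚ-- a (+ 1)))
    step₁ : ∀ b′ A P ι → b′ * ((A - 1ℚ - P) * ι) * A ≡ b′ * A * ((A - 1ℚ - P) * ι)
    step₁ = solve-∀ ℚ-ring
    step₂ : ∀ b A P ι → b * (A - P) * ((A - 1ℚ - P) * ι) ≡ b * ((A - P) * ι) * (A - (1ℚ + P))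
    step₂ = solve-∀ ℚ-ring

  -- Absorption rewrites the left side as (X(X-1) + 2XY + Y(Y-1)) binom(a, p) with X = Λ - a and
  -- Y = a - p, and X(X-1) + 2XY + Y(Y-1) = (X+Y)(X+Y-1).
  binomℤ-three-term : ∀ Λ a p →
    (Λ - ℤtoℚ a) * (Λ - 1ℚ - ℤtoℚ a) * binomℤ a p
      + ℤtoℚ (+ 2) * ℤtoℚ a * (Λ - ℤtoℚ a) * binomℤ (a ℤ.- + 1) p
      + ℤtoℚ a * (ℤtoℚ a - 1ℚ) * binomℤ (a ℤ.- + 2) p
    ≡ (Λ - ℕtoℚ p) * (Λ - ℕtoℚ p - 1ℚ) * binomℤ a p
  binomℤ-three-term Λ a p = begin
    X * (Λ - 1ℚ - A) * b₀ + ℤtoℚ (+ 2) * A * X * b₁ + A * (A - 1ℚ) * b₂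
      ≡⟨ step₁ X Λ A b₀ b₁ b₂ ⟩
    X * (Λ - 1ℚ - A) * b₀ + ℤtoℚ (+ 2) * X * (b₁ * A) + A * (b₂ * (A - 1ℚ))
      ≡⟨ cong₂ (λ x y → X * (Λ - 1ℚ - A) * b₀ + ℤtoℚ (+ 2) * X * x + A * y) absorb₁ absorb₂ ⟩
    X * (Λ - 1ℚ - A) * b₀ + ℤtoℚ (+ 2) * X * (b₀ * (A - P)) + A * (b₁ * (A - 1ℚ - P))
      ≡⟨ step₂ X Λ A P b₀ b₁ ⟩
    X * (Λ - 1ℚ - A) * b₀ + ℤtoℚ (+ 2) * X * (b₀ * (A - P)) + b₁ * A * (A - 1ℚ - P)
      ≡⟨ cong (λ x → X * (Λ - 1ℚ - A) * b₀ + ℤtoℚ (+ 2) * X * (b₀ * (A - P)) + x * (A - 1ℚ - P)) absorb₁ ⟩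
    X * (Λ - 1ℚ - A) * b₀ + ℤtoℚ (+ 2) * X * (b₀ * (A - P)) + b₀ * (A - P) * (A - 1ℚ - P)
      ≡⟨ collect Λ A P b₀ ⟩
    (Λ - P) * (Λ - P - 1ℚ) * b₀ ∎
    where
    open ≡-Reasoning
    A = ℤtoℚ a
    P = ℕtoℚ p
    X = Λ - A
    b₀ = binomℤ a p
    b₁ = binomℤ (a ℤ.- + 1) p
    b₂ = binomℤ (a ℤ.- + 2) p
    absorb₁ : b₁ * A ≡ b₀ * (A - P)
    absorb₁ = [a-1]Cp*a≡aCp*[a-p] a p
    absorb₂ : b₂ * (A - 1ℚ) ≡ b₁ * (A - 1ℚ - P)
    absorb₂ = begin
      b₂ * (A - 1ℚ)                                       ≡⟨ cong₂ (λ c x → binomℤ c p * x) a-2 (ℤtoℚ-- a (+ 1)) ⟨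
      binomℤ (a ℤ.- + 1 ℤ.- + 1) p * ℤtoℚ (a ℤ.- + 1)     ≡⟨ [a-1]Cp*a≡aCp*[a-p] (a ℤ.- + 1) p ⟩
      b₁ * (ℤtoℚ (a ℤ.- + 1) - P)                          ≡⟨ cong (λ x → b₁ * (x - P)) (ℤtoℚ-- a (+ 1)) ⟩
      b₁ * (A - 1ℚ - P)                                   ∎
      where
      a-2 : a ℤ.- + 1 ℤ.- + 1 ≡ a ℤ.- + 2
      a-2 = ℤ.+-assoc a (ℤ.- + 1) (ℤ.- + 1)
    step₁ : ∀ X Λ A b₀ b₁ b₂ → X * (Λ - 1ℚ - A) * b₀ + ℤtoℚ (+ 2) * A * X * b₁ + A * (A - 1ℚ) * b₂
      ≡ X * (Λ - 1ℚ - A) * b₀ + ℤtoℚ (+ 2) * X * (b₁ * A) + A * (b₂ * (A - 1ℚ))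
    step₁ = solve-∀ ℚ-ring
    step₂ : ∀ X Λ A P b₀ b₁ → X * (Λ - 1ℚ - A) * b₀ + ℤtoℚ (+ 2) * X * (b₀ * (A - P)) + A * (b₁ * (A - 1ℚ - P))
      ≡ X * (Λ - 1ℚ - A) * b₀ + ℤtoℚ (+ 2) * X * (b₀ * (A - P)) + b₁ * A * (A - 1ℚ - P)
    step₂ = solve-∀ ℚ-ring
    collect : ∀ Λ A P b₀ → (Λ - A) * (Λ - 1ℚ - A) * b₀ + ℤtoℚ (+ 2) * (Λ - A) * (b₀ * (A - P))
      + b₀ * (A - P) * (A - 1ℚ - P) ≡ (Λ - P) * (Λ - P - 1ℚ) * b₀
    collect = solve-∀ ℚ-ring

  innerSum-recurrence : ∀ a L t Λ → Λ ≡ ℕtoℚ (L ℕ.+ 2 ℕ.* suc t) →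
    ℕtoℚ (2 ℕ.* suc t ℕ.* suc (2 ℕ.* t)) * innerSum a L (suc (suc t))
      ≡ (Λ - ℤtoℚ a) * (Λ - 1ℚ - ℤtoℚ a) * innerSum a L (suc t)
        + ℤtoℚ (+ 2) * ℤtoℚ a * (Λ - ℤtoℚ a) * innerSum (a ℤ.- + 1) L (suc t)
        + ℤtoℚ a * (ℤtoℚ a - 1ℚ) * innerSum (a ℤ.- + 2) L (suc t)
  innerSum-recurrence a L t Λ Λ≡ =
    *-sumOver-combination₃ (ℕtoℚ (2 ℕ.* suc t ℕ.* suc (2 ℕ.* t)))
      ((Λ - ℤtoℚ a) * (Λ - 1ℚ - ℤtoℚ a)) (ℤtoℚ (+ 2) * ℤtoℚ a * (Λ - ℤtoℚ a)) (ℤtoℚ a * (ℤtoℚ a - 1ℚ))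
      (All.map (λ n<1+L → term-recurrence _ (ℕ.≤-pred n<1+L)) (all-upTo (suc L)))
    where
    term-recurrence : ∀ n → n ≤ L →
      ℕtoℚ (2 ℕ.* suc t ℕ.* suc (2 ℕ.* t))
        * (binomℤ a (L ℕ.∸ n) * ℕtoℚ ((n ℕ.+ 2 ℕ.* suc (suc t) ℕ.∸ 2) C n) * bernoulli n)
      ≡ (Λ - ℤtoℚ a) * (Λ - 1ℚ - ℤtoℚ a)
          * (binomℤ a (L ℕ.∸ n) * ℕtoℚ ((n ℕ.+ 2 ℕ.* suc t ℕ.∸ 2) C n) * bernoulli n)
        + ℤtoℚ (+ 2) * ℤtoℚ a * (Λ - ℤtoℚ a)
          * (binomℤ (a ℤ.- + 1) (L ℕ.∸ n) * ℕtoℚ ((n ℕ.+ 2 ℕ.* suc t ℕ.∸ 2) C n) * bernoulli n)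
        + ℤtoℚ a * (ℤtoℚ a - 1ℚ)
          * (binomℤ (a ℤ.- + 2) (L ℕ.∸ n) * ℕtoℚ ((n ℕ.+ 2 ℕ.* suc t ℕ.∸ 2) C n) * bernoulli n)
    term-recurrence n n≤L = begin
      N * (b₀ * c₂ * B)                           ≡⟨ step₁ N b₀ c₂ B ⟩
      b₀ * B * (N * c₂)                           ≡⟨ cong (b₀ * B *_) weights ⟩
      b₀ * B * ((Λ - P) * (Λ - P - 1ℚ) * c₀)      ≡⟨ step₂ b₀ B (Λ - P) (Λ - P - 1ℚ) c₀ ⟩
      (Λ - P) * (Λ - P - 1ℚ) * b₀ * (c₀ * B)      ≡⟨ cong (_* (c₀ * B)) (binomℤ-three-term Λ a p) ⟨
      (α * b₀ + β * b₁ + γ * b₂) * (c₀ * B)       ≡⟨ step₃ α β γ b₀ b₁ b₂ c₀ B ⟩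
      α * (b₀ * c₀ * B) + β * (b₁ * c₀ * B) + γ * (b₂ * c₀ * B) ∎
      where
      open ≡-Reasoning
      A = ℤtoℚ a
      α = (Λ - A) * (Λ - 1ℚ - A)
      β = ℤtoℚ (+ 2) * A * (Λ - A)
      γ = A * (A - 1ℚ)
      p = L ℕ.∸ n
      P = ℕtoℚ p
      m = n ℕ.+ 2 ℕ.* t
      N = ℕtoℚ (2 ℕ.* suc t ℕ.* suc (2 ℕ.* t))
      b₀ = binomℤ a p
      b₁ = binomℤ (a ℤ.- + 1) p
      b₂ = binomℤ (a ℤ.- + 2) p
      c₀ = ℕtoℚ ((n ℕ.+ 2 ℕ.* suc t ℕ.∸ 2) C n)
      c₂ = ℕtoℚ ((n ℕ.+ 2 ℕ.* suc (suc t) ℕ.∸ 2) C n)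
      B = bernoulli n
      step₁ : ∀ N b₀ c₂ B → N * (b₀ * c₂ * B) ≡ b₀ * B * (N * c₂)
      step₁ = solve-∀ ℚ-ring
      step₂ : ∀ b₀ B x y c₀ → b₀ * B * (x * y * c₀) ≡ x * y * b₀ * (c₀ * B)
      step₂ = solve-∀ ℚ-ring
      step₃ : ∀ α β γ b₀ b₁ b₂ c₀ B →
        (α * b₀ + β * b₁ + γ * b₂) * (c₀ * B) ≡ α * (b₀ * c₀ * B) + β * (b₁ * c₀ * B) + γ * (b₂ * c₀ * B)
      step₃ = solve-∀ ℚ-ring
      index₀ : n ℕ.+ 2 ℕ.* suc t ℕ.∸ 2 ≡ m
      index₀ = cong (ℕ._∸ 2) (shift n t)
        where
        shift : ∀ n t → n ℕ.+ 2 ℕ.* suc t ≡ 2 ℕ.+ (n ℕ.+ 2 ℕ.* t)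
        shift = ℕ-Solver.solve-∀
      index₂ : n ℕ.+ 2 ℕ.* suc (suc t) ℕ.∸ 2 ≡ 2 ℕ.+ m
      index₂ = cong (ℕ._∸ 2) (shift n t)
        where
        shift : ∀ n t → n ℕ.+ 2 ℕ.* suc (suc t) ≡ 2 ℕ.+ (2 ℕ.+ (n ℕ.+ 2 ℕ.* t))
        shift = ℕ-Solver.solve-∀
      Λ-P : Λ - P ≡ ℕtoℚ (2 ℕ.+ m)
      Λ-P = begin
        Λ - P                                     ≡⟨ cong (_- P) Λ≡ ⟩
        ℕtoℚ (L ℕ.+ 2 ℕ.* suc t) - P              ≡⟨ cong (λ x → ℕtoℚ x - P) L+2[t+1]≡2+m+p ⟩
        ℕtoℚ (2 ℕ.+ m ℕ.+ p) - P                  ≡⟨ cong (_- P) (ℕtoℚ-+ (2 ℕ.+ m) p) ⟩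
        ℕtoℚ (2 ℕ.+ m) + P - P                    ≡⟨ cancel (ℕtoℚ (2 ℕ.+ m)) P ⟩
        ℕtoℚ (2 ℕ.+ m)                            ∎
        where
        cancel : ∀ x y → x + y - y ≡ x
        cancel = solve-∀ ℚ-ring
        L+2[t+1]≡2+m+p : L ℕ.+ 2 ℕ.* suc t ≡ 2 ℕ.+ m ℕ.+ p
        L+2[t+1]≡2+m+p = trans (cong (ℕ._+ 2 ℕ.* suc t) (sym (ℕ.m+[n∸m]≡n n≤L))) (regroup n p t)
          where
          regroup : ∀ n p t → n ℕ.+ p ℕ.+ 2 ℕ.* suc t ≡ 2 ℕ.+ (n ℕ.+ 2 ℕ.* t) ℕ.+ p
          regroup = ℕ-Solver.solve-∀
      Λ-P-1 : Λ - P - 1ℚ ≡ ℕtoℚ (1 ℕ.+ m)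
      Λ-P-1 = trans (cong (_- 1ℚ) (trans Λ-P (ℕtoℚ-+ 1 (1 ℕ.+ m)))) (cancel (ℕtoℚ (1 ℕ.+ m)))
        where
        cancel : ∀ x → 1ℚ + x - 1ℚ ≡ x
        cancel = solve-∀ ℚ-ring
      weights : N * c₂ ≡ (Λ - P) * (Λ - P - 1ℚ) * c₀
      weights = begin
        N * c₂
          ≡⟨ ℕtoℚ-* (2 ℕ.* suc t ℕ.* suc (2 ℕ.* t)) ((n ℕ.+ 2 ℕ.* suc (suc t) ℕ.∸ 2) C n) ⟨
        ℕtoℚ (2 ℕ.* suc t ℕ.* suc (2 ℕ.* t) ℕ.* ((n ℕ.+ 2 ℕ.* suc (suc t) ℕ.∸ 2) C n))
          ≡⟨ cong ℕtoℚ (cong₂ (λ x y → x ℕ.* suc (2 ℕ.* t) ℕ.* (y C n)) (ℕ.*-suc 2 t) index₂) ⟩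
        ℕtoℚ ((2 ℕ.+ 2 ℕ.* t) ℕ.* (1 ℕ.+ 2 ℕ.* t) ℕ.* ((2 ℕ.+ m) C n))
          ≡⟨ cong ℕtoℚ ([c+2]*[c+1]*[n+c+2]Cn≡[n+c+2]*[n+c+1]*[n+c]Cn n (2 ℕ.* t)) ⟩
        ℕtoℚ ((2 ℕ.+ m) ℕ.* (1 ℕ.+ m) ℕ.* (m C n))
          ≡⟨ trans (ℕtoℚ-* ((2 ℕ.+ m) ℕ.* (1 ℕ.+ m)) (m C n))
                   (cong (_* ℕtoℚ (m C n)) (ℕtoℚ-* (2 ℕ.+ m) (1 ℕ.+ m))) ⟩
        ℕtoℚ (2 ℕ.+ m) * ℕtoℚ (1 ℕ.+ m) * ℕtoℚ (m C n)
          ≡⟨ cong₂ (λ x z → x * ℕtoℚ (z C n)) (sym (cong₂ _*_ Λ-P Λ-P-1)) (sym index₀) ⟩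
        (Λ - P) * (Λ - P - 1ℚ) * c₀ ∎

  Φ-coeff : ℤ → ℕ → ℤ → ℕ → ℚ
  Φ-coeff c M a t = (c / suc (2 ℕ.* t)) * innerSum a (2 ℕ.* M ℕ.∸ 1 ℕ.∸ 2 ℕ.* t) (suc t)

  Φ-exp : ℕ → ℕ → ℕ × ℕ
  Φ-exp M t = 2 ℕ.* M ℕ.∸ 2 ℕ.* suc t , suc (2 ℕ.* t)

  -- F M j = Φ -2 M j and G M j = Φ 2 M (2M - 1 - j), definitionally.
  Φ : ℤ → ℕ → ℤ → Poly
  Φ c M a = terms (Φ-coeff c M a) (Φ-exp M) (upTo (M ℕ.∸ 1))

  2M∸1∸2t+2[t+1]≡2M+1 : ∀ M t → t < M → 2 ℕ.* M ℕ.∸ 1 ℕ.∸ 2 ℕ.* t ℕ.+ 2 ℕ.* suc t ≡ 2 ℕ.* M ℕ.+ 1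
  2M∸1∸2t+2[t+1]≡2M+1 M t t<M = begin
    2 ℕ.* M ℕ.∸ 1 ℕ.∸ 2 ℕ.* t ℕ.+ 2 ℕ.* suc t
      ≡⟨ cong₂ ℕ._+_ (ℕ.∸-+-assoc (2 ℕ.* M) 1 (2 ℕ.* t)) (ℕ.*-suc 2 t) ⟩
    2 ℕ.* M ℕ.∸ suc (2 ℕ.* t) ℕ.+ suc (suc (2 ℕ.* t)) ≡⟨ ℕ.+-suc _ (suc (2 ℕ.* t)) ⟩
    suc (2 ℕ.* M ℕ.∸ suc (2 ℕ.* t) ℕ.+ suc (2 ℕ.* t)) ≡⟨ cong suc (ℕ.m∸n+n≡m 1+2t≤2M) ⟩
    suc (2 ℕ.* M)                                    ≡⟨ ℕ.+-comm 1 (2 ℕ.* M) ⟩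
    2 ℕ.* M ℕ.+ 1                                    ∎
    where
    open ≡-Reasoning
    1+2t≤2M : suc (2 ℕ.* t) ≤ 2 ℕ.* M
    1+2t≤2M = ℕ.≤-trans (ℕ.n≤1+n _) (subst (ℕ._≤ 2 ℕ.* M) (ℕ.*-suc 2 t) (ℕ.*-monoʳ-≤ 2 t<M))

  Φ-coeff-recurrence : ∀ c a M t → t < M → let m = + (2 ℕ.* M ℕ.+ 1) in
    Φ-coeff c (suc M) a (suc t) * ℕtoℚ (suc (2 ℕ.* suc t) ℕ.* (2 ℕ.* suc t))
      ≡ ℤtoℚ ((m ℤ.- a) ℤ.* (m ℤ.- + 1 ℤ.- a)) * Φ-coeff c M a t
        + ℤtoℚ (ℤ.- (+ 2 ℤ.* a ℤ.* (m ℤ.- a))) * Φ-coeff (ℤ.- c) M (a ℤ.- + 1) t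
        + ℤtoℚ (a ℤ.* (a ℤ.- + 1)) * Φ-coeff c M (a ℤ.- + 2) t
  Φ-coeff-recurrence c a M t t<M = begin
    (c / suc (2 ℕ.* suc t)) * innerSum a L′ (suc (suc t)) * ℕtoℚ (suc (2 ℕ.* suc t) ℕ.* (2 ℕ.* suc t))
      ≡⟨ cong₂ _*_ (cong₂ _*_ (z/n≡z*[1/n] c (2 ℕ.* suc t)) (cong (λ l → innerSum a l (suc (suc t))) L′≡L))
                   (ℕtoℚ-* (suc (2 ℕ.* suc t)) (2 ℕ.* suc t)) ⟩
    κ * ι₁ * S * (n₃ * n₂)             ≡⟨ step₁ κ ι₁ S n₃ n₂ ⟩
    κ * (ι₁ * n₃) * n₂ * S             ≡⟨ cong (λ x → κ * x * n₂ * S) (trans (1/n*n≡1 (2 ℕ.* suc t)) (sym (1/n*n≡1 (2 ℕ.* t)))) ⟩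
    κ * (ι₀ * n₁) * n₂ * S             ≡⟨ step₂ κ ι₀ n₁ n₂ S ⟩
    κ * ι₀ * (n₂ * n₁ * S)             ≡⟨ cong (λ x → κ * ι₀ * (x * S)) (ℕtoℚ-* n₂′ n₁′) ⟨
    κ * ι₀ * (N * S)                   ≡⟨ cong (κ * ι₀ *_) (innerSum-recurrence a L t Λ Λ≡) ⟩
    κ * ι₀ * (α′ * S₀ + β′ * S₁ + γ′ * S₂)
      ≡⟨ step₃ κ ι₀ α′ β′ γ′ S₀ S₁ S₂ ⟩
    α′ * (κ * ι₀ * S₀) + (- β′) * ((- κ) * ι₀ * S₁) + γ′ * (κ * ι₀ * S₂)
      ≡⟨ cong₂ _+_ (cong₂ _+_ (cong₂ _*_ (sym α≡) (cong (_* S₀) (sym c/[2t+1])))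
                              (cong₂ _*_ (sym β≡) (cong (_* S₁) (sym -c/[2t+1]))))
                   (cong₂ _*_ (sym γ≡) (cong (_* S₂) (sym c/[2t+1]))) ⟩
    α * u₀ + β * u₁ + γ * u₂ ∎
    where
    open ≡-Reasoning
    m = + (2 ℕ.* M ℕ.+ 1)
    L = 2 ℕ.* M ℕ.∸ 1 ℕ.∸ 2 ℕ.* t
    L′ = 2 ℕ.* suc M ℕ.∸ 1 ℕ.∸ 2 ℕ.* suc t
    L′≡L : L′ ≡ L
    L′≡L = trans (cong₂ (λ x y → x ℕ.∸ 1 ℕ.∸ y) (ℕ.*-suc 2 M) (ℕ.*-suc 2 t))
                 (sym (ℕ.∸-+-assoc (2 ℕ.* M) 1 (2 ℕ.* t)))
    Λ = ℤtoℚ m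
    Λ≡ : Λ ≡ ℕtoℚ (L ℕ.+ 2 ℕ.* suc t)
    Λ≡ = cong ℕtoℚ (sym (2M∸1∸2t+2[t+1]≡2M+1 M t t<M))
    A = ℤtoℚ a
    κ = ℤtoℚ c
    ι₀ = + 1 / suc (2 ℕ.* t)
    ι₁ = + 1 / suc (2 ℕ.* suc t)
    n₁′ = suc (2 ℕ.* t)
    n₂′ = 2 ℕ.* suc t
    n₁ = ℕtoℚ n₁′
    n₂ = ℕtoℚ n₂′
    n₃ = ℕtoℚ (suc (2 ℕ.* suc t))
    N = ℕtoℚ (n₂′ ℕ.* n₁′)
    c/[2t+1] : c / suc (2 ℕ.* t) ≡ κ * ι₀
    c/[2t+1] = z/n≡z*[1/n] c (2 ℕ.* t)
    -c/[2t+1] : ℤ.- c / suc (2 ℕ.* t) ≡ (- κ) * ι₀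
    -c/[2t+1] = trans (z/n≡z*[1/n] (ℤ.- c) (2 ℕ.* t)) (cong (_* ι₀) (ℤtoℚ-neg c))
    S = innerSum a L (suc (suc t))
    S₀ = innerSum a L (suc t)
    S₁ = innerSum (a ℤ.- + 1) L (suc t)
    S₂ = innerSum (a ℤ.- + 2) L (suc t)
    α′ = (Λ - A) * (Λ - 1ℚ - A)
    β′ = ℤtoℚ (+ 2) * A * (Λ - A)
    γ′ = A * (A - 1ℚ)
    α = ℤtoℚ ((m ℤ.- a) ℤ.* (m ℤ.- + 1 ℤ.- a))
    β = ℤtoℚ (ℤ.- (+ 2 ℤ.* a ℤ.* (m ℤ.- a)))
    γ = ℤtoℚ (a ℤ.* (a ℤ.- + 1))
    u₀ = Φ-coeff c M a t
    u₁ = Φ-coeff (ℤ.- c) M (a ℤ.- + 1) t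
    u₂ = Φ-coeff c M (a ℤ.- + 2) t
    α≡ : α ≡ α′
    α≡ = trans (ℤtoℚ-* (m ℤ.- a) (m ℤ.- + 1 ℤ.- a)) (cong₂ _*_ (ℤtoℚ-- m a)
           (trans (ℤtoℚ-- (m ℤ.- + 1) a) (cong (_- A) (ℤtoℚ-- m (+ 1)))))
    β≡ : β ≡ - β′
    β≡ = trans (ℤtoℚ-neg (+ 2 ℤ.* a ℤ.* (m ℤ.- a)))
               (cong -_ (trans (ℤtoℚ-* (+ 2 ℤ.* a) (m ℤ.- a)) (cong₂ _*_ (ℤtoℚ-* (+ 2) a) (ℤtoℚ-- m a))))
    γ≡ : γ ≡ γ′
    γ≡ = trans (ℤtoℚ-* a (a ℤ.- + 1)) (cong (A *_) (ℤtoℚ-- a (+ 1)))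
    step₁ : ∀ κ ι₁ S n₃ n₂ → κ * ι₁ * S * (n₃ * n₂) ≡ κ * (ι₁ * n₃) * n₂ * S
    step₁ = solve-∀ ℚ-ring
    step₂ : ∀ κ ι₀ n₁ n₂ S → κ * (ι₀ * n₁) * n₂ * S ≡ κ * ι₀ * (n₂ * n₁ * S)
    step₂ = solve-∀ ℚ-ring
    step₃ : ∀ κ ι₀ α′ β′ γ′ S₀ S₁ S₂ → κ * ι₀ * (α′ * S₀ + β′ * S₁ + γ′ * S₂)
      ≡ α′ * (κ * ι₀ * S₀) + (- β′) * ((- κ) * ι₀ * S₁) + γ′ * (κ * ι₀ * S₂)
    step₃ = solve-∀ ℚ-ring

  ∂y²-term : ℚ × ℕ × ℕ → ℚ × ℕ × ℕ
  ∂y²-term (c , a , b) = c * ℕtoℚ (b ℕ.* (b ℕ.∸ 1)) , a , b ℕ.∸ 2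

  coeff-∷-*0 : ∀ a b q e p → coeff a b ((q * 0ℚ , e) ∷ p) ≡ coeff a b p
  coeff-∷-*0 a b q e p = trans (cong (_+ coeff a b p) (select-* x (q * 0ℚ))) (vanish (select x 1ℚ) q (coeff a b p))
    where
    x = ⌊ a ℕ.≟ proj₁ e ⌋ ∧ ⌊ b ℕ.≟ proj₂ e ⌋
    vanish : ∀ s q r → s * (q * 0ℚ) + r ≡ r
    vanish = solve-∀ ℚ-ring

  ∂y²-Φ : ∀ c a M → let m = + (2 ℕ.* M ℕ.+ 1) in
    ∂y² (Φ c (suc M) a) ≈ₚ
      ℤtoℚ ((m ℤ.- a) ℤ.* (m ℤ.- + 1 ℤ.- a)) · Φ c M a
      ⊕ ℤtoℚ (ℤ.- (+ 2 ℤ.* a ℤ.* (m ℤ.- a))) · Φ (ℤ.- c) M (a ℤ.- + 1)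
      ⊕ ℤtoℚ (a ℤ.* (a ℤ.- + 1)) · Φ c M (a ℤ.- + 2)
  ∂y²-Φ c a zero    _ _ = refl
  -- ∂y² kills the t = 0 term (a multiple of y); the term t + 1 becomes the term t one level down.
  ∂y²-Φ c a (suc M) u v = begin
    coeff u v (∂y² (Φ c (suc (suc M)) a))
      ≡⟨ coeff-∷-*0 u v (Φ-coeff c (suc (suc M)) a 0) _ (∂y² (map f (List.applyUpTo suc M))) ⟩
    coeff u v (∂y² (map f (List.applyUpTo suc M)))
      ≡⟨ cong (coeff u v) tail≡ ⟩
    coeff u v (terms (λ t → α * u₀ t + β * u₁ t + γ * u₂ t) (Φ-exp (suc M)) (upTo M))
      ≡⟨ terms-combination₃ α β γ u₀ u₁ u₂ (Φ-exp (suc M)) (upTo M) u v ⟩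
    coeff u v (α · Φ c (suc M) a ⊕ β · Φ (ℤ.- c) (suc M) (a ℤ.- + 1) ⊕ γ · Φ c (suc M) (a ℤ.- + 2)) ∎
    where
    open ≡-Reasoning
    m = + (2 ℕ.* suc M ℕ.+ 1)
    α = ℤtoℚ ((m ℤ.- a) ℤ.* (m ℤ.- + 1 ℤ.- a))
    β = ℤtoℚ (ℤ.- (+ 2 ℤ.* a ℤ.* (m ℤ.- a)))
    γ = ℤtoℚ (a ℤ.* (a ℤ.- + 1))
    u₀ = Φ-coeff c (suc M) a
    u₁ = Φ-coeff (ℤ.- c) (suc M) (a ℤ.- + 1)
    u₂ = Φ-coeff c (suc M) (a ℤ.- + 2)
    f = λ t → Φ-coeff c (suc (suc M)) a t , Φ-exp (suc (suc M)) t
    tail≡ : ∂y² (map f (List.applyUpTo suc M)) ≡ terms (λ t → α * u₀ t + β * u₁ t + γ * u₂ t) (Φ-exp (suc M)) (upTo M)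
    tail≡ = trans (sym (List.map-∘ (List.applyUpTo suc M)))
            (trans (List.map-applyUpTo suc (∂y²-term ∘ f) M)
            (trans (sym (List.map-upTo (∂y²-term ∘ f ∘ suc) M))
                   (List.map-cong-local (All.map (λ t<M → ∂y²-term-f (ℕ.m<n⇒m<1+n t<M)) (all-upTo M)))))
      where
      ∂y²-term-f : ∀ {t} → t < suc M → ∂y²-term (f (suc t)) ≡ (α * u₀ t + β * u₁ t + γ * u₂ t , Φ-exp (suc M) t)
      ∂y²-term-f {t} t<1+M = cong₂ _,_ (Φ-coeff-recurrence c a (suc M) t t<1+M)
        (cong₂ _,_ (cong₂ ℕ._∸_ (ℕ.*-suc 2 (suc M)) (ℕ.*-suc 2 (suc t))) (cong (λ x → suc x ℕ.∸ 2) (ℕ.*-suc 2 t)))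

  combination₃-cong : ∀ {α α′ β β′ γ γ′ p p′ q q′ r r′} →
    α ≡ α′ → p ≡ p′ → β ≡ β′ → q ≡ q′ → γ ≡ γ′ → r ≡ r′ →
    α · p ⊕ β · q ⊕ γ · r ≡ α′ · p′ ⊕ β′ · q′ ⊕ γ′ · r′
  combination₃-cong refl refl refl refl refl refl = refl

  ∂y²-F : ∀ M j k → k ≡ + (2 ℕ.* M ℕ.+ 1) ℤ.+ + 2 →
    ∂y² (F (suc M) j) ≈ₚ
      ℤtoℚ ((k ℤ.- + 2 ℤ.- j) ℤ.* (k ℤ.- + 3 ℤ.- j)) · F M j
      ⊕ ℤtoℚ (ℤ.- (+ 2 ℤ.* j ℤ.* (k ℤ.- + 2 ℤ.- j))) · G M (k ℤ.- + 3 ℤ.- j)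
      ⊕ ℤtoℚ (j ℤ.* (j ℤ.- + 1)) · F M (j ℤ.- + 2)
  ∂y²-F M j _ refl a b = trans (∂y²-Φ ℤ.-[1+ 1 ] j M a b) (cong (coeff a b) coefficients≡)
    where
    m = + (2 ℕ.* M ℕ.+ 1)
    k = m ℤ.+ + 2
    coefficients≡ :
      ℤtoℚ ((m ℤ.- j) ℤ.* (m ℤ.- + 1 ℤ.- j)) · F M j
        ⊕ ℤtoℚ (ℤ.- (+ 2 ℤ.* j ℤ.* (m ℤ.- j))) · Φ (+ 2) M (j ℤ.- + 1)
        ⊕ ℤtoℚ (j ℤ.* (j ℤ.- + 1)) · F M (j ℤ.- + 2)
      ≡ ℤtoℚ ((k ℤ.- + 2 ℤ.- j) ℤ.* (k ℤ.- + 3 ℤ.- j)) · F M j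
        ⊕ ℤtoℚ (ℤ.- (+ 2 ℤ.* j ℤ.* (k ℤ.- + 2 ℤ.- j))) · G M (k ℤ.- + 3 ℤ.- j)
        ⊕ ℤtoℚ (j ℤ.* (j ℤ.- + 1)) · F M (j ℤ.- + 2)
    coefficients≡ = cong₂ (λ x y → x ⊕ y ⊕ ℤtoℚ (j ℤ.* (j ℤ.- + 1)) · F M (j ℤ.- + 2))
      (cong (_· F M j) (cong ℤtoℚ (α≡ m j))) (cong₂ _·_ (cong ℤtoℚ (β≡ m j)) (cong (Φ (+ 2) M) (j-1≡ m j)))
      where
      α≡ : ∀ m j → (m ℤ.- j) ℤ.* (m ℤ.- + 1 ℤ.- j) ≡ (m ℤ.+ + 2 ℤ.- + 2 ℤ.- j) ℤ.* (m ℤ.+ + 2 ℤ.- + 3 ℤ.- j)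
      α≡ = ℤ-Solver.solve-∀
      β≡ : ∀ m j → ℤ.- (+ 2 ℤ.* j ℤ.* (m ℤ.- j)) ≡ ℤ.- (+ 2 ℤ.* j ℤ.* (m ℤ.+ + 2 ℤ.- + 2 ℤ.- j))
      β≡ = ℤ-Solver.solve-∀
      j-1≡ : ∀ m j → j ℤ.- + 1 ≡ m ℤ.- + 2 ℤ.- (m ℤ.+ + 2 ℤ.- + 3 ℤ.- j)
      j-1≡ = ℤ-Solver.solve-∀

  ∂y²-G : ∀ M j k → k ≡ + (2 ℕ.* M ℕ.+ 1) ℤ.+ + 2 →
    ∂y² (G (suc M) j) ≈ₚ
      ℤtoℚ ((k ℤ.- + 2 ℤ.- j) ℤ.* (k ℤ.- + 3 ℤ.- j)) · G M j
      ⊕ ℤtoℚ (ℤ.- (+ 2 ℤ.* j ℤ.* (k ℤ.- + 2 ℤ.- j))) · F M (k ℤ.- + 3 ℤ.- j)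
      ⊕ ℤtoℚ (j ℤ.* (j ℤ.- + 1)) · G M (j ℤ.- + 2)
  -- G is Φ at a = m - j, where the outer coefficients of the Φ recurrence trade places.
  ∂y²-G M j _ refl u v = begin
    coeff u v (∂y² (G (suc M) j))
      ≡⟨ cong (λ a → coeff u v (∂y² (Φ (+ 2) (suc M) a))) top≡m-j ⟩
    coeff u v (∂y² (Φ (+ 2) (suc M) a))
      ≡⟨ ∂y²-Φ (+ 2) a M u v ⟩
    coeff u v (α · Φ (+ 2) M a ⊕ β · Φ ℤ.-[1+ 1 ] M (a ℤ.- + 1) ⊕ γ · Φ (+ 2) M (a ℤ.- + 2))
      ≡⟨ ⊕-reverse (α · Φ (+ 2) M a) (β · Φ ℤ.-[1+ 1 ] M (a ℤ.- + 1)) (γ · Φ (+ 2) M (a ℤ.- + 2)) u v ⟩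
    coeff u v (γ · Φ (+ 2) M (a ℤ.- + 2) ⊕ β · Φ ℤ.-[1+ 1 ] M (a ℤ.- + 1) ⊕ α · Φ (+ 2) M a)
      ≡⟨ cong (coeff u v) (combination₃-cong (cong ℤtoℚ (γ≡ m j)) (cong (Φ (+ 2) M) (a-2≡ m j))
                                              (cong ℤtoℚ (β≡ m j)) (cong (Φ ℤ.-[1+ 1 ] M) (a-1≡ m j))
                                              (cong ℤtoℚ (α≡ m j)) (cong (Φ (+ 2) M) (a≡ m j))) ⟩
    coeff u v (ℤtoℚ ((k ℤ.- + 2 ℤ.- j) ℤ.* (k ℤ.- + 3 ℤ.- j)) · G M j
               ⊕ ℤtoℚ (ℤ.- (+ 2 ℤ.* j ℤ.* (k ℤ.- + 2 ℤ.- j))) · F M (k ℤ.- + 3 ℤ.- j)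
               ⊕ ℤtoℚ (j ℤ.* (j ℤ.- + 1)) · G M (j ℤ.- + 2)) ∎
    where
    open ≡-Reasoning
    m = + (2 ℕ.* M ℕ.+ 1)
    k = m ℤ.+ + 2
    a = m ℤ.- j
    α = ℤtoℚ ((m ℤ.- a) ℤ.* (m ℤ.- + 1 ℤ.- a))
    β = ℤtoℚ (ℤ.- (+ 2 ℤ.* a ℤ.* (m ℤ.- a)))
    γ = ℤtoℚ (a ℤ.* (a ℤ.- + 1))
    top≡m-j : + (2 ℕ.* suc M ℕ.+ 1) ℤ.- + 2 ℤ.- j ≡ a
    top≡m-j = trans (cong (λ n → + n ℤ.- + 2 ℤ.- j) (shift M)) (cancel m j)
      where
      shift : ∀ M → 2 ℕ.* suc M ℕ.+ 1 ≡ 2 ℕ.* M ℕ.+ 1 ℕ.+ 2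
      shift = ℕ-Solver.solve-∀
      cancel : ∀ m j → m ℤ.+ + 2 ℤ.- + 2 ℤ.- j ≡ m ℤ.- j
      cancel = ℤ-Solver.solve-∀
    γ≡ : ∀ m j → (m ℤ.- j) ℤ.* (m ℤ.- j ℤ.- + 1) ≡ (m ℤ.+ + 2 ℤ.- + 2 ℤ.- j) ℤ.* (m ℤ.+ + 2 ℤ.- + 3 ℤ.- j)
    γ≡ = ℤ-Solver.solve-∀
    a-2≡ : ∀ m j → m ℤ.- j ℤ.- + 2 ≡ m ℤ.- + 2 ℤ.- j
    a-2≡ = ℤ-Solver.solve-∀
    β≡ : ∀ m j → ℤ.- (+ 2 ℤ.* (m ℤ.- j) ℤ.* (m ℤ.- (m ℤ.- j))) ≡ ℤ.- (+ 2 ℤ.* j ℤ.* (m ℤ.+ + 2 ℤ.- + 2 ℤ.- j))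
    β≡ = ℤ-Solver.solve-∀
    a-1≡ : ∀ m j → m ℤ.- j ℤ.- + 1 ≡ m ℤ.+ + 2 ℤ.- + 3 ℤ.- j
    a-1≡ = ℤ-Solver.solve-∀
    α≡ : ∀ m j → (m ℤ.- (m ℤ.- j)) ℤ.* (m ℤ.- + 1 ℤ.- (m ℤ.- j)) ≡ j ℤ.* (j ℤ.- + 1)
    α≡ = ℤ-Solver.solve-∀
    a≡ : ∀ m j → m ℤ.- j ≡ m ℤ.- + 2 ℤ.- (j ℤ.- + 2)
    a≡ = ℤ-Solver.solve-∀

open import Data.Nat using (_∸_; _*_)

-- The identities hold for every integer i and every K ≥ 1.
lemma1 : (K : ℕ) → 2 ≤ K → (i : ℕ) → i ≤ 2 * K ∸ 1 →
    (∂y² (F K (+ i)) ≈ₚ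
      ℤtoℚ ((+ suc (2 * K) ℤ.- + 2 ℤ.- + i) ℤ.* (+ suc (2 * K) ℤ.- + 3 ℤ.- + i)) · F (K ∸ 1) (+ i)
      ⊕ ℤtoℚ (ℤ.- (+ 2 ℤ.* + i ℤ.* (+ suc (2 * K) ℤ.- + 2 ℤ.- + i))) · G (K ∸ 1) (+ suc (2 * K) ℤ.- + 3 ℤ.- + i)
      ⊕ ℤtoℚ (+ i ℤ.* (+ i ℤ.- + 1)) · F (K ∸ 1) (+ i ℤ.- + 2))
  × (∂y² (G K (+ i)) ≈ₚ
      ℤtoℚ ((+ suc (2 * K) ℤ.- + 2 ℤ.- + i) ℤ.* (+ suc (2 * K) ℤ.- + 3 ℤ.- + i)) · G (K ∸ 1) (+ i)
      ⊕ ℤtoℚ (ℤ.- (+ 2 ℤ.* + i ℤ.* (+ suc (2 * K) ℤ.- + 2 ℤ.- + i))) · F (K ∸ 1) (+ suc (2 * K) ℤ.- + 3 ℤ.- + i)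
      ⊕ ℤtoℚ (+ i ℤ.* (+ i ℤ.- + 1)) · G (K ∸ 1) (+ i ℤ.- + 2))
lemma1 zero    ()
lemma1 (suc M) _ i _ = ∂y²-F M (+ i) k k≡m+2 , ∂y²-G M (+ i) k k≡m+2
  where
  k = + suc (2 * suc M)
  k≡m+2 : k ≡ + (2 * M ℕ.+ 1) ℤ.+ + 2
  k≡m+2 = cong +_ (shift M)
    where
    shift : ∀ M → suc (2 * suc M) ≡ 2 * M ℕ.+ 1 ℕ.+ 2
    shift = ℕ-Solver.solve-∀
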